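{- Let $k$ and $m$ be positive integers with $k$ odd. If a finite graph $G$ is $(2mk:mk)$-choosable, then $G$ is also $2m$-choosable.
   Context: A graph $G=(V,E)$ is $(a:b)$-choosable if for every family of sets $\{S(v):v\in V\}$ with $|S(v)|=a$ for all $v$, there are subsets $C(v)\subseteq S(v)$ with $|C(v)|=b$ for all $v$ and $C(u)\cap C(v)=\emptyset$ for every two adjacent $u,v$. $G$ is $k$-choosable if it is $(k:1)$-choosable. -}

module Defs where

open import Data.Nat using (ℕ)
open import Data.Fin using (Fin)
open import Data.List using (List; length)
open import Data.List.Membership.Propositional using (_∈_)
open import Data.List.Relation.Unary.Unique.Propositional using (Unique)
open import Data.Product using (Σ; _×_)
open import Relation.Nullary using (¬_; Dec)
open import Relation.Binary.PropositionalEquality using (_≡_)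

record Graph : Set₁ where
  field
    n      : ℕ
    Adj    : Fin n → Fin n → Set
    adj?   : ∀ u v → Dec (Adj u v)
    sym    : ∀ {u v} → Adj u v → Adj v u
    irrefl : ∀ {v} → ¬ Adj v v
open Graph public

record ColourSet (a : ℕ) : Set where
  constructor mkSet
  field
    elems  : List ℕ
    unique : Unique elems
    size   : length elems ≡ a
open ColourSet public

_⊆ₛ_ : ∀ {a b} → ColourSet b → ColourSet a → Set
C ⊆ₛ S = ∀ {x} → x ∈ elems C → x ∈ elems S

Disjoint : ∀ {a b} → ColourSet a → ColourSet b → Set
Disjoint C D = ∀ {x} → x ∈ elems C → ¬ (x ∈ elems D)

Choosable : Graph → ℕ → ℕ → Set
Choosable G a b =
  (S : Fin (n G) → ColourSet a) →
  Σ (Fin (n G) → ColourSet b) λ C →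
    (∀ v → C v ⊆ₛ S v) × (∀ u v → Adj G u v → Disjoint (C u) (C v))

kChoosable : Graph → ℕ → Set
kChoosable G k = Choosable G k 1

module Submission where

-- Replace every colour c by the block of k fresh colours
-- B(c) = {ck, …, ck + k - 1}; equivalently, x ∈ B(c) iff x / k ≡ c.
-- A list assignment L with |L(v)| = 2m becomes S(v) = ⋃_{c ∈ L(v)} B(c),
-- of size 2mk, so (2mk:mk)-choosability yields C(v) ⊆ S(v), |C(v)| = mk,
-- proper on every edge.  Call c heavy for C(v) if more than j colours of
-- B(c) lie in C(v).  Pigeonhole: if no c ∈ L(v) were heavy, then
-- mk = |C(v)| ≤ 2m·j < m(2j+1) — so pick a heavy c(v) ∈ L(v).  If uv is an
-- edge, C(u) and C(v) are disjoint, so c(u) = c(v) would put at least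
-- 2(j+1) > k distinct colours into B(c(u)), which has only k.

open import Defs hiding (sym)
open import Data.Fin using (Fin)
open import Data.Nat using (ℕ; suc; _*_; _+_; _<_; _≤_; _≟_; _≤?_; z≤n; s≤s; NonZero; >-nonZero)
open import Data.Nat.Properties
open import Data.Nat.DivMod using (_/_; _%_; m%n<n; m≡m%n+[m/n]*n; m*n/n≡m; m<n⇒m/n≡0; +-distrib-/-∣ˡ)
open import Data.Nat.Divisibility using (divides-refl)
open import Data.Nat.ListAction using (sum)
open import Data.Nat.Tactic.RingSolver using (solve-∀)
open import Data.List using (List; []; _∷_; _++_; length; map; filter; applyUpTo)
open import Data.List.Properties using (length-++; length-applyUpTo; length-removeAt′; filter-accept)
open import Data.List.Membership.Propositional using (_∈_; find)
open import Data.List.Membership.Propositional.Properties using (∈-++⁻; ∈-applyUpTo⁺; ∈-applyUpTo⁻; ∈-filter⁻)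
open import Data.List.Relation.Unary.Any using (here; there; index; _─_)
open import Data.List.Relation.Unary.All as All using (All; []; _∷_; all?)
open import Data.List.Relation.Unary.All.Properties using (¬All⇒Any¬)
open import Data.List.Relation.Unary.AllPairs using ([]; _∷_)
open import Data.List.Relation.Unary.Unique.Propositional using (Unique)
open import Data.List.Relation.Unary.Unique.Propositional.Properties using (++⁺; applyUpTo⁺₁; filter⁺)
open import Data.Product using (Σ; ∃; _×_; _,_; proj₁; proj₂)
open import Data.Sum using (inj₁; inj₂)
open import Data.Empty using (⊥)
open import Relation.Binary.Definitions using (DecidableEquality)
open import Relation.Nullary using (yes; no; contradiction)
open import Relation.Binary.PropositionalEquality using (_≡_; _≢_; refl; sym; trans; cong; cong₂; subst; module ≡-Reasoning)

∈-─⁺ : ∀ {A : Set} {x z : A} {ys} (x∈ys : x ∈ ys) → z ∈ ys → x ≢ z → z ∈ (ys ─ x∈ys)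
∈-─⁺ (here refl) (here refl) x≢z = contradiction refl x≢z
∈-─⁺ (here refl) (there z∈ys) _  = z∈ys
∈-─⁺ (there _)   (here refl)  _  = here refl
∈-─⁺ (there x∈ys) (there z∈ys) x≢z = there (∈-─⁺ x∈ys z∈ys x≢z)

unique-⊆⇒length≤ : ∀ {A : Set} {xs ys : List A} → Unique xs → (∀ {z} → z ∈ xs → z ∈ ys) →
                   length xs ≤ length ys
unique-⊆⇒length≤ {xs = []} _ _ = z≤n
unique-⊆⇒length≤ {xs = x ∷ xs} {ys} (x∉xs ∷ xs-unique) xs⊆ys =
  subst (suc (length xs) ≤_) (sym (length-removeAt′ ys (index x∈ys)))
    (s≤s (unique-⊆⇒length≤ xs-unique
      (λ z∈xs → ∈-─⁺ x∈ys (xs⊆ys (there z∈xs)) (All.lookup x∉xs z∈xs))))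
  where
  x∈ys : x ∈ ys
  x∈ys = xs⊆ys (here refl)

sum-map-mono-≤ : ∀ {B : Set} {g h : B → ℕ} → (∀ b → g b ≤ h b) →
                 ∀ bs → sum (map g bs) ≤ sum (map h bs)
sum-map-mono-≤ g≤h []       = z≤n
sum-map-mono-≤ g≤h (b ∷ bs) = +-mono-≤ (g≤h b) (sum-map-mono-≤ g≤h bs)

sum-map-mono-< : ∀ {B : Set} {g h : B → ℕ} {b₀ bs} → (∀ b → g b ≤ h b) →
                 b₀ ∈ bs → g b₀ < h b₀ → sum (map g bs) < sum (map h bs)
sum-map-mono-< {bs = _ ∷ bs} g≤h (here refl) g<h = +-mono-<-≤ g<h (sum-map-mono-≤ g≤h bs)
sum-map-mono-< {bs = b ∷ _} g≤h (there b₀∈bs) g<h = +-mono-≤-< (g≤h b) (sum-map-mono-< g≤h b₀∈bs g<h)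

sum-map-≤ : ∀ {B : Set} {g : B → ℕ} {j} bs → All (λ b → g b ≤ j) bs → sum (map g bs) ≤ length bs * j
sum-map-≤ []       []         = z≤n
sum-map-≤ (b ∷ bs) (gb≤j ∷ ≤j) = +-mono-≤ gb≤j (sum-map-≤ bs ≤j)

pigeonhole : ∀ {B : Set} (g : B → ℕ) j bs → length bs * j < sum (map g bs) → ∃ λ b → b ∈ bs × j < g b
pigeonhole g j bs large with all? (λ b → g b ≤? j) bs
... | yes all≤j = contradiction (sum-map-≤ bs all≤j) (<⇒≱ large)
... | no ¬all≤j with b , b∈bs , gb≰j ← find (¬All⇒Any¬ (λ b → g b ≤? j) bs ¬all≤j) = b , b∈bs , ≰⇒> gb≰j

module Fibres {A B : Set} (_≟ᴮ_ : DecidableEquality B) (f : A → B) where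

  fibre : B → List A → List A
  fibre b = filter (λ x → f x ≟ᴮ b)

  ∈-fibre⁻ : ∀ {x b} xs → x ∈ fibre b xs → x ∈ xs × f x ≡ b
  ∈-fibre⁻ {b = b} xs = ∈-filter⁻ (λ y → f y ≟ᴮ b) {xs = xs}

  fibre-unique : ∀ b {xs} → Unique xs → Unique (fibre b xs)
  fibre-unique b = filter⁺ (λ y → f y ≟ᴮ b)

  fibre-∷-≤ : ∀ x xs b → length (fibre b xs) ≤ length (fibre b (x ∷ xs))
  fibre-∷-≤ x xs b with f x ≟ᴮ b
  ... | yes _ = n≤1+n _
  ... | no  _ = ≤-refl

  fibre-∷-< : ∀ x xs → length (fibre (f x) xs) < length (fibre (f x) (x ∷ xs))
  fibre-∷-< x xs = ≤-reflexive (cong length (sym (filter-accept (λ y → f y ≟ᴮ f x) refl)))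

  length≤sum-fibres : ∀ xs bs → (∀ {x} → x ∈ xs → f x ∈ bs) →
                      length xs ≤ sum (map (λ b → length (fibre b xs)) bs)
  length≤sum-fibres []       bs _     = z≤n
  length≤sum-fibres (x ∷ xs) bs xs↦bs =
    ≤-trans (s≤s (length≤sum-fibres xs bs (λ x∈xs → xs↦bs (there x∈xs))))
            (sum-map-mono-< (fibre-∷-≤ x xs) (xs↦bs (here refl)) (fibre-∷-< x xs))

module Blocks (k : ℕ) .{{_ : NonZero k}} where

  block : ℕ → List ℕ
  block c = applyUpTo (c * k +_) k

  ∈-block⁻ : ∀ {x c} → x ∈ block c → x / k ≡ c
  ∈-block⁻ {c = c} x∈block with i , i<k , refl ← ∈-applyUpTo⁻ (c * k +_) x∈block = begin
    (c * k + i) / k   ≡⟨ +-distrib-/-∣ˡ i (divides-refl c) ⟩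
    c * k / k + i / k ≡⟨ cong₂ _+_ (m*n/n≡m c k) (m<n⇒m/n≡0 i<k) ⟩
    c + 0             ≡⟨ +-identityʳ c ⟩
    c                 ∎
    where open ≡-Reasoning

  ∈-block⁺ : ∀ {x c} → x / k ≡ c → x ∈ block c
  ∈-block⁺ {x} refl = subst (_∈ block (x / k)) [x/k]k+x%k≡x (∈-applyUpTo⁺ (x / k * k +_) (m%n<n x k))
    where
    [x/k]k+x%k≡x : x / k * k + x % k ≡ x
    [x/k]k+x%k≡x = trans (+-comm (x / k * k) (x % k)) (sym (m≡m%n+[m/n]*n x k))

  block-unique : ∀ c → Unique (block c)
  block-unique c = applyUpTo⁺₁ (c * k +_) k
    (λ i<j _ eq → <⇒≢ i<j (+-cancelˡ-≡ (c * k) _ _ eq))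

  blowUp : List ℕ → List ℕ
  blowUp []       = []
  blowUp (c ∷ cs) = block c ++ blowUp cs

  length-blowUp : ∀ cs → length (blowUp cs) ≡ length cs * k
  length-blowUp []       = refl
  length-blowUp (c ∷ cs) = trans (length-++ (block c))
                                 (cong₂ _+_ (length-applyUpTo (c * k +_) k) (length-blowUp cs))

  ∈-blowUp⁻ : ∀ {x} cs → x ∈ blowUp cs → x / k ∈ cs
  ∈-blowUp⁻ (c ∷ cs) x∈ with ∈-++⁻ (block c) x∈
  ... | inj₁ x∈block = here (∈-block⁻ x∈block)
  ... | inj₂ x∈rest  = there (∈-blowUp⁻ cs x∈rest)

  blowUp-unique : ∀ cs → Unique cs → Unique (blowUp cs)
  blowUp-unique []       _                 = []
  blowUp-unique (c ∷ cs) (c∉cs ∷ cs-unique) =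
    ++⁺ (block-unique c) (blowUp-unique cs cs-unique)
        (λ (x∈block , x∈rest) → All.lookup c∉cs (∈-blowUp⁻ cs x∈rest) (sym (∈-block⁻ x∈block)))

  blowUpSet : ∀ {a} → ColourSet a → ColourSet (a * k)
  blowUpSet S = mkSet (blowUp (elems S)) (blowUp-unique (elems S) (unique S))
                      (trans (length-blowUp (elems S)) (cong (_* k) (size S)))

  open Fibres _≟_ (_/ k)

  Heavy : ℕ → ∀ {b} → ColourSet b → ℕ → Set
  Heavy j C c = j < length (fibre c (elems C))

  heavy-colour : ∀ {a b} j (L : ColourSet a) (C : ColourSet b) → C ⊆ₛ blowUpSet L → a * j < b →
                 ∃ λ c → c ∈ elems L × Heavy j C c
  heavy-colour {a} {b} j L C C⊆S large =
    pigeonhole (λ c → length (fibre c (elems C))) j (elems L) (begin-strict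
      length (elems L) * j ≡⟨ cong (_* j) (size L) ⟩
      a * j                <⟨ large ⟩
      b                    ≡⟨ size C ⟨
      length (elems C)     ≤⟨ length≤sum-fibres (elems C) (elems L) (λ x∈C → ∈-blowUp⁻ (elems L) (C⊆S x∈C)) ⟩
      _                    ∎)
    where open ≤-Reasoning

  -- Two disjoint colour sets cannot both be j-heavy at c once k ≤ 2j + 1:
  -- their fibres over c are disjoint duplicate-free subsets of block c.
  heavy-exclusive : ∀ {a b} j (C : ColourSet a) (D : ColourSet b) {c} → k ≤ 2 * j + 1 →
                    Disjoint C D → Heavy j C c → Heavy j D c → ⊥
  heavy-exclusive j C D {c} k≤2j+1 C∩D=∅ heavyC heavyD = <-irrefl refl (begin-strict
    2 * j + 1                          <⟨ s≤s (≤-reflexive (two-halves j)) ⟩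
    suc j + suc j                      ≤⟨ +-mono-≤ heavyC heavyD ⟩
    length Cc + length Dc              ≡⟨ length-++ Cc ⟨
    length (Cc ++ Dc)                  ≤⟨ unique-⊆⇒length≤ both-unique both⊆block ⟩
    length (block c)                   ≡⟨ length-applyUpTo (c * k +_) k ⟩
    k                                  ≤⟨ k≤2j+1 ⟩
    2 * j + 1                          ∎)
    where
    open ≤-Reasoning
    Cc = fibre c (elems C)
    Dc = fibre c (elems D)

    two-halves : ∀ j → 2 * j + 1 ≡ j + suc j
    two-halves = solve-∀

    both-unique : Unique (Cc ++ Dc)
    both-unique = ++⁺ (fibre-unique c (unique C)) (fibre-unique c (unique D))
      (λ (x∈Cc , x∈Dc) → C∩D=∅ (proj₁ (∈-fibre⁻ (elems C) x∈Cc)) (proj₁ (∈-fibre⁻ (elems D) x∈Dc)))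

    both⊆block : ∀ {x} → x ∈ Cc ++ Dc → x ∈ block c
    both⊆block x∈ with ∈-++⁻ Cc x∈
    ... | inj₁ x∈Cc = ∈-block⁺ (proj₂ (∈-fibre⁻ (elems C) x∈Cc))
    ... | inj₂ x∈Dc = ∈-block⁺ (proj₂ (∈-fibre⁻ (elems D) x∈Dc))

singleton : ℕ → ColourSet 1
singleton c = mkSet (c ∷ []) ([] ∷ []) refl

-- 2m·j < m·(2j + 1) for m > 0: a 2m-list with all blocks j-light is too small.
2mj<m[2j+1] : ∀ j m → 0 < m → 2 * m * j < m * (2 * j + 1)
2mj<m[2j+1] j m 0<m = subst (2 * m * j <_) (identity j m) (m<m+n (2 * m * j) 0<m)
  where
  identity : ∀ j m → 2 * m * j + m ≡ m * (2 * j + 1)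
  identity = solve-∀

theorem5p3 : (k m : ℕ) → 0 < k → 0 < m → (∃ λ j → k ≡ 2 * j + 1) → (G : Graph) →
    Choosable G (2 * m * k) (m * k) → kChoosable G (2 * m)
theorem5p3 k m 0<k 0<m (j , refl) G choosable L = colour , colour⊆L , colour-proper
  where
  open Blocks k {{>-nonZero 0<k}}

  blockChoice : Σ (Fin (n G) → ColourSet (m * k)) λ C →
                  (∀ v → C v ⊆ₛ blowUpSet (L v)) × (∀ u v → Adj G u v → Disjoint (C u) (C v))
  blockChoice = choosable (λ v → blowUpSet (L v))

  C : Fin (n G) → ColourSet (m * k)
  C = proj₁ blockChoice

  heavy : ∀ v → ∃ λ c → c ∈ elems (L v) × Heavy j (C v) c
  heavy v = heavy-colour j (L v) (C v) (proj₁ (proj₂ blockChoice) v) (2mj<m[2j+1] j m 0<m)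

  colour : Fin (n G) → ColourSet 1
  colour v = singleton (proj₁ (heavy v))

  colour⊆L : ∀ v → colour v ⊆ₛ L v
  colour⊆L v (here refl) = proj₁ (proj₂ (heavy v))

  colour-proper : ∀ u v → Adj G u v → Disjoint (colour u) (colour v)
  colour-proper u v uv (here refl) (here same) =
    heavy-exclusive j (C u) (C v) ≤-refl (proj₂ (proj₂ blockChoice) u v uv)
      (proj₂ (proj₂ (heavy u))) (subst (Heavy j (C v)) (sym same) (proj₂ (proj₂ (heavy v))))
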